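{- $\mathbf{K_N^{Horn,\Box}}$ is closed under intersection of models: if $\varphi$ is a $\mathbf{K_N^{Horn,\Box}}$-formula, $M_1=(\mathcal F,V_1)$ and $M_2=(\mathcal F,V_2)$ are models on the same frame $\mathcal F$ with set of worlds $W$, $w\in W$, and $M_1,w\Vdash\varphi$ and $M_2,w\Vdash\varphi$, then $M_{M_1\cap M_2},w\Vdash\varphi$.
   Context: Fix a finite set $\tau$ of modality labels and a countable set $\mathcal P$ of propositional letters. Formulas of $\mathbf{K_N}$ are generated by $\varphi ::= \top \mid p \mid \neg\varphi \mid \varphi\vee\varphi \mid \Diamond_\alpha\varphi \mid \Box_\alpha\varphi$ ($p\in\mathcal P$, $\alpha\in\tau$); $\wedge,\rightarrow$ are abbreviations and $\bot=\neg\top$. A frame $\mathcal F=(W,\{R_\alpha\}_{\alpha\in\tau})$ has $W\ne\emptyset$ and $R_\alpha\subseteq W\times W$; a model $(\mathcal F,V)$ adds $V:W\to2^{\mathcal P}$, with standard Kripke semantics. Positive literals: $\lambda ::= \top \mid p \mid \Diamond_\alpha\lambda \mid \Box_\alpha\lambda$. A formula is in clausal form if generated by $\varphi ::= \lambda \mid \neg\lambda \mid \nabla(\neg\lambda_1\vee\dots\vee\neg\lambda_n\vee\lambda_{n+1}\vee\dots\vee\lambda_{n+m}) \mid \varphi\wedge\varphi$, where the $\lambda,\lambda_i$ are positive literals and $\nabla$ is a finite (possibly empty) sequence of boxes. $\mathbf{K_N^{Horn}}$: every clause has $m\le 1$. $\mathbf{K_N^{Horn,\Box}}$ is the subfragment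 of $\mathbf{K_N^{Horn}}$ in which positive literals contain no diamonds, i.e. $\lambda ::= \top\mid p\mid \Box_\alpha\lambda$ (boxes in prefixes $\nabla$ are allowed). For models $M_1=(\mathcal F,V_1)$, $M_2=(\mathcal F,V_2)$ on the same frame, the intersection model is $M_{M_1\cap M_2}=(\mathcal F,V)$ with $V(w)=V_1(w)\cap V_2(w)$ for all $w\in W$. -}

module Defs where

open import Data.Nat using (ℕ; _≤_)
open import Data.Fin using (Fin)
open import Data.List using (List; []; _∷_; length)
open import Data.Product using (_×_; Σ; ∃)
open import Data.Sum using (_⊎_)
open import Data.Unit using (⊤)
open import Data.Empty using (⊥)
open import Relation.Nullary using (¬_)
open import Level using (Level; suc; _⊔_)

-- Modality labels: a finite set τ, represented as Fin k.
-- Propositional letters: countable set 𝒫, represented as ℕ.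

data Formula (k : ℕ) : Set where
  ⊤ᶠ  : Formula k
  var : ℕ → Formula k
  ¬ᶠ_ : Formula k → Formula k
  _∨ᶠ_ : Formula k → Formula k → Formula k
  ◇ : Fin k → Formula k → Formula k
  □ : Fin k → Formula k → Formula k

⊥ᶠ : ∀ {k} → Formula k
⊥ᶠ = ¬ᶠ ⊤ᶠ

_∧ᶠ_ : ∀ {k} → Formula k → Formula k → Formula k
φ ∧ᶠ ψ = ¬ᶠ ((¬ᶠ φ) ∨ᶠ (¬ᶠ ψ))

-- Frames and models (worlds in an arbitrary type W; nonemptiness is witnessed
-- by the world w in the statement).
record Frame (k : ℕ) : Set₁ where
  field
    W : Set
    R : Fin k → W → W → Set

-- valuation V : W → 2^𝒫, given as a membership predicate: V w p means p ∈ V(w)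
Valuation : ∀ {k} → Frame k → Set₁
Valuation F = Frame.W F → ℕ → Set

_,_,_⊩_ : ∀ {k} (F : Frame k) → Valuation F → Frame.W F → Formula k → Set
F , V , w ⊩ ⊤ᶠ = ⊤
F , V , w ⊩ var p = V w p
F , V , w ⊩ (¬ᶠ φ) = ¬ (F , V , w ⊩ φ)
F , V , w ⊩ (φ ∨ᶠ ψ) = (F , V , w ⊩ φ) ⊎ (F , V , w ⊩ ψ)
F , V , w ⊩ ◇ a φ = Σ (Frame.W F) (λ v → Frame.R F a w v × (F , V , v ⊩ φ))
F , V , w ⊩ □ a φ = ∀ v → Frame.R F a w v → F , V , v ⊩ φ

_∩ⱽ_ : ∀ {k} {F : Frame k} → Valuation F → Valuation F → Valuation F
(V₁ ∩ⱽ V₂) w p = V₁ w p × V₂ w p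

data BoxLiteral {k : ℕ} : Formula k → Set where
  lit-⊤ : BoxLiteral ⊤ᶠ
  lit-var : ∀ p → BoxLiteral (var p)
  lit-□ : ∀ a {λ'} → BoxLiteral λ' → BoxLiteral (□ a λ')

⋁ : ∀ {k} → List (Formula k) → Formula k
⋁ [] = ⊥ᶠ
⋁ (φ ∷ []) = φ
⋁ (φ ∷ ψ ∷ φs) = φ ∨ᶠ ⋁ (ψ ∷ φs)

data AllBoxLit {k : ℕ} : List (Formula k) → Set where
  []  : AllBoxLit []
  _∷_ : ∀ {φ φs} → BoxLiteral φ → AllBoxLit φs → AllBoxLit (φ ∷ φs)

negs : ∀ {k} → List (Formula k) → List (Formula k)
negs [] = []
negs (φ ∷ φs) = (¬ᶠ φ) ∷ negs φs

data HornBoxBody {k : ℕ} : Formula k → Set where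
  body : ∀ (ns ps : List (Formula k)) → AllBoxLit ns → AllBoxLit ps →
         length ps ≤ 1 → HornBoxBody (⋁ (Data.List._++_ (negs ns) ps))

-- ∇ (a finite, possibly empty, sequence of boxes) applied to a clause body
data BoxedHornClause {k : ℕ} : Formula k → Set where
  here : ∀ {φ} → HornBoxBody φ → BoxedHornClause φ
  box  : ∀ a {φ} → BoxedHornClause φ → BoxedHornClause (□ a φ)

data HornBox {k : ℕ} : Formula k → Set where
  pos    : ∀ {φ} → BoxLiteral φ → HornBox φ
  neg    : ∀ {φ} → BoxLiteral φ → HornBox (¬ᶠ φ)
  clause : ∀ {φ} → BoxedHornClause φ → HornBox φ
  conj   : ∀ {φ ψ} → HornBox φ → HornBox ψ → HornBox (φ ∧ᶠ ψ)

-- Diamond-free positive literals are monotone in the valuation and preserved by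
-- intersection, since □ commutes with pointwise intersection.  Negated
-- literals are then inherited by the smaller intersection model from either
-- model.  In a Horn clause, if a negative disjunct holds in M₁ or in M₂ it holds
-- in the intersection; otherwise both models satisfy the unique positive
-- literal, which is preserved.  Box prefixes and conjunction keep formulas
-- closed under intersection.
module Submission where

open import Defs
open import Data.Nat using (ℕ; _≤_; s≤s)
open import Data.List using ([]; _∷_; _++_; length)
open import Data.List.Relation.Unary.Any using (Any; here; there)
open import Data.List.Relation.Unary.Any.Properties using (++⁺ˡ; ++⁺ʳ; ++⁻)
open import Data.Product using (_,_; proj₁; proj₂)
open import Data.Sum using (_⊎_; inj₁; inj₂)
open import Data.Unit using (tt)
open import Data.Empty using (⊥-elim)

module _ {k : ℕ} (F : Frame k) where

  _⊆ⱽ_ : Valuation F → Valuation F → Set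
  V ⊆ⱽ V′ = ∀ w p → V w p → V′ w p

  BoxLiteral-⊩-mono : ∀ {V V′ φ} → V ⊆ⱽ V′ → BoxLiteral φ →
                      ∀ w → F , V , w ⊩ φ → F , V′ , w ⊩ φ
  BoxLiteral-⊩-mono V⊆V′ lit-⊤         w _ = tt
  BoxLiteral-⊩-mono V⊆V′ (lit-var p)   w h = V⊆V′ w p h
  BoxLiteral-⊩-mono V⊆V′ (lit-□ a lit) w h = λ v r → BoxLiteral-⊩-mono V⊆V′ lit v (h v r)

  Any-negs-antitone : ∀ {V V′ ns} → V′ ⊆ⱽ V → AllBoxLit ns → ∀ w →
                      Any (F , V , w ⊩_) (negs ns) → Any (F , V′ , w ⊩_) (negs ns)
  Any-negs-antitone V′⊆V (lit ∷ lits) w (here ¬h) = here (λ h → ¬h (BoxLiteral-⊩-mono V′⊆V lit w h))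
  Any-negs-antitone V′⊆V (lit ∷ lits) w (there h) = there (Any-negs-antitone V′⊆V lits w h)

  ⊩-⋁⇒Any : ∀ {V} w φs → F , V , w ⊩ ⋁ φs → Any (F , V , w ⊩_) φs
  ⊩-⋁⇒Any w []           h        = ⊥-elim (h tt)
  ⊩-⋁⇒Any w (φ ∷ [])     h        = here h
  ⊩-⋁⇒Any w (φ ∷ ψ ∷ φs) (inj₁ h) = here h
  ⊩-⋁⇒Any w (φ ∷ ψ ∷ φs) (inj₂ h) = there (⊩-⋁⇒Any w (ψ ∷ φs) h)

  Any⇒⊩-⋁ : ∀ {V} w φs → Any (F , V , w ⊩_) φs → F , V , w ⊩ ⋁ φs
  Any⇒⊩-⋁ w (φ ∷ [])     (here h)   = h
  Any⇒⊩-⋁ w (φ ∷ ψ ∷ φs) (here h)   = inj₁ h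
  Any⇒⊩-⋁ w (φ ∷ ψ ∷ φs) (there h)  = inj₂ (Any⇒⊩-⋁ w (ψ ∷ φs) h)

  module _ (V₁ V₂ : Valuation F) where

    V₁∩V₂ : Valuation F
    V₁∩V₂ = _∩ⱽ_ {F = F} V₁ V₂

    ∩ⱽ-⊆ˡ : V₁∩V₂ ⊆ⱽ V₁
    ∩ⱽ-⊆ˡ w p = proj₁

    ∩ⱽ-⊆ʳ : V₁∩V₂ ⊆ⱽ V₂
    ∩ⱽ-⊆ʳ w p = proj₂

    IntersectionClosed : Formula k → Set
    IntersectionClosed φ = ∀ w → F , V₁ , w ⊩ φ → F , V₂ , w ⊩ φ → F , V₁∩V₂ , w ⊩ φ

    BoxLiteral-∩-closed : ∀ {φ} → BoxLiteral φ → IntersectionClosed φ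
    BoxLiteral-∩-closed lit-⊤         w _  _  = tt
    BoxLiteral-∩-closed (lit-var p)   w h₁ h₂ = h₁ , h₂
    BoxLiteral-∩-closed (lit-□ a lit) w h₁ h₂ = λ v r → BoxLiteral-∩-closed lit v (h₁ v r) (h₂ v r)

    ¬BoxLiteral-∩-closed : ∀ {φ} → BoxLiteral φ → IntersectionClosed (¬ᶠ φ)
    ¬BoxLiteral-∩-closed lit w ¬h₁ _ h = ¬h₁ (BoxLiteral-⊩-mono ∩ⱽ-⊆ˡ lit w h)

    □-∩-closed : ∀ {φ} a → IntersectionClosed φ → IntersectionClosed (□ a φ)
    □-∩-closed a closed w h₁ h₂ = λ v r → closed v (h₁ v r) (h₂ v r)

    ∧-∩-closed : ∀ {φ ψ} → IntersectionClosed φ → IntersectionClosed ψ → IntersectionClosed (φ ∧ᶠ ψ)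
    ∧-∩-closed closedφ closedψ w h₁ h₂ (inj₁ ¬φ) =
      h₁ (inj₁ λ φ₁ → h₂ (inj₁ λ φ₂ → ¬φ (closedφ w φ₁ φ₂)))
    ∧-∩-closed closedφ closedψ w h₁ h₂ (inj₂ ¬ψ) =
      h₁ (inj₂ λ ψ₁ → h₂ (inj₂ λ ψ₂ → ¬ψ (closedψ w ψ₁ ψ₂)))

    Any-atMostOne-∩-closed : ∀ {ps} → AllBoxLit ps → length ps ≤ 1 → ∀ w →
                             Any (F , V₁ , w ⊩_) ps → Any (F , V₂ , w ⊩_) ps →
                             Any (F , V₁∩V₂ , w ⊩_) ps
    Any-atMostOne-∩-closed (lit ∷ []) _ w (here h₁) (here h₂) = here (BoxLiteral-∩-closed lit w h₁ h₂)
    Any-atMostOne-∩-closed (_ ∷ _ ∷ _) (s≤s ()) w _ _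

    HornBoxBody-∩-closed : ∀ {φ} → HornBoxBody φ → IntersectionClosed φ
    HornBoxBody-∩-closed (body ns ps neg-lits pos-lits atMostOne) w h₁ h₂ =
      Any⇒⊩-⋁ w (negs ns ++ ps)
        (combine (++⁻ (negs ns) (⊩-⋁⇒Any w _ h₁)) (++⁻ (negs ns) (⊩-⋁⇒Any w _ h₂)))
      where
      combine : Any (F , V₁ , w ⊩_) (negs ns) ⊎ Any (F , V₁ , w ⊩_) ps →
                Any (F , V₂ , w ⊩_) (negs ns) ⊎ Any (F , V₂ , w ⊩_) ps →
                Any (F , V₁∩V₂ , w ⊩_) (negs ns ++ ps)
      combine (inj₁ n₁) _         = ++⁺ˡ (Any-negs-antitone ∩ⱽ-⊆ˡ neg-lits w n₁)
      combine (inj₂ _)  (inj₁ n₂) = ++⁺ˡ (Any-negs-antitone ∩ⱽ-⊆ʳ neg-lits w n₂)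
      combine (inj₂ p₁) (inj₂ p₂) = ++⁺ʳ (negs ns) (Any-atMostOne-∩-closed pos-lits atMostOne w p₁ p₂)

    BoxedHornClause-∩-closed : ∀ {φ} → BoxedHornClause φ → IntersectionClosed φ
    BoxedHornClause-∩-closed (here b)  = HornBoxBody-∩-closed b
    BoxedHornClause-∩-closed (box a {φ} c) = □-∩-closed {φ} a (BoxedHornClause-∩-closed c)

    HornBox-∩-closed : ∀ {φ} → HornBox φ → IntersectionClosed φ
    HornBox-∩-closed (pos lit)  = BoxLiteral-∩-closed lit
    HornBox-∩-closed (neg lit)  = ¬BoxLiteral-∩-closed lit
    HornBox-∩-closed (clause c) = BoxedHornClause-∩-closed c
    HornBox-∩-closed (conj {φ} {ψ} p q) = ∧-∩-closed {φ} {ψ} (HornBox-∩-closed p) (HornBox-∩-closed q)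

lemma1 : ∀ (k : ℕ) (φ : Formula k) → HornBox φ →
         ∀ (F : Frame k) (V₁ V₂ : Valuation F) (w : Frame.W F) →
         F , V₁ , w ⊩ φ → F , V₂ , w ⊩ φ → F , (_∩ⱽ_ {F = F} V₁ V₂) , w ⊩ φ
lemma1 k φ hornBox F V₁ V₂ = HornBox-∩-closed F V₁ V₂ hornBox
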